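{- Let $x,y$ be integers with $x\ge 0$ and $M(x,y)\ne\emptyset$, and let $G_0$ be a minimal graph in $M(x,y)$. Then (a) $\alpha(G_0)<3$ (so $G_0$ is an $(\omega(G_0)+1,3)$-graph); (b) $|V(G_0)|\le 2\chi(G_0)-1$; (c) $|V(G_0)|\ge 4f(G_0)-2x-1$.
   Context: All graphs are finite, simple and undirected (the graph with empty vertex set is allowed). $\chi(G)$ is the chromatic number, $\omega(G)$ the clique number, $\alpha(G)$ the independence number, and $f(G)=\chi(G)-\omega(G)$. A graph is a $(p,q)$-graph if $\omega(G)<p$ and $\alpha(G)<q$. For integers $x,y$, $M(x,y)$ is the set of graphs $G$ with $|V(G)|<\chi(G)+2f(G)-x$ and $f(G)\le y$. A minimal graph in a nonempty set $\mathcal M$ of graphs is a $G_0\in\mathcal M$ with $|V(G_0)|=\min\{|V(G)|:G\in\mathcal M\}$. -}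

module Defs where

open import Data.Nat using (ℕ; _≤_)
open import Data.Fin using (Fin)
open import Data.Bool using (Bool; true; false)
open import Data.Integer as ℤ using (ℤ; +_)
open import Data.Product using (Σ; _×_; ∃; ∃-syntax)
open import Relation.Binary.PropositionalEquality using (_≡_; _≢_)
open import Function.Definitions using (Injective)

record Graph (n : ℕ) : Set where
  field
    adj   : Fin n → Fin n → Bool
    sym   : ∀ u v → adj u v ≡ adj v u
    irrefl : ∀ v → adj v v ≡ false
open Graph public

Colouring : ∀ {n} → Graph n → ℕ → Set
Colouring {n} G k = Σ (Fin n → Fin k) λ c → ∀ u v → adj G u v ≡ true → c u ≢ c v

Clique : ∀ {n} → Graph n → ℕ → Set
Clique {n} G w = Σ (Fin w → Fin n) λ f →
  Injective _≡_ _≡_ f × (∀ i j → i ≢ j → adj G (f i) (f j) ≡ true)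

Independent : ∀ {n} → Graph n → ℕ → Set
Independent {n} G a = Σ (Fin a → Fin n) λ f →
  Injective _≡_ _≡_ f × (∀ i j → i ≢ j → adj G (f i) (f j) ≡ false)

IsChromaticNumber : ∀ {n} → Graph n → ℕ → Set
IsChromaticNumber G k = Colouring G k × (∀ j → Colouring G j → k ≤ j)

IsCliqueNumber : ∀ {n} → Graph n → ℕ → Set
IsCliqueNumber G w = Clique G w × (∀ j → Clique G j → j ≤ w)

IsIndependenceNumber : ∀ {n} → Graph n → ℕ → Set
IsIndependenceNumber G a = Independent G a × (∀ j → Independent G j → j ≤ a)

-- G ∈ M(x,y):  |V(G)| < χ(G) + 2 f(G) − x  and  f(G) ≤ y,  where f = χ − ω
InM : ℤ → ℤ → ∀ {n} → Graph n → Set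
InM x y {n} G = ∃[ c ] ∃[ w ] (IsChromaticNumber G c × IsCliqueNumber G w ×
  ((+ n) ℤ.< (+ c) ℤ.+ (+ 2) ℤ.* ((+ c) ℤ.- (+ w)) ℤ.- x) ×
  ((+ c) ℤ.- (+ w) ℤ.≤ y))

IsMinimalInM : ℤ → ℤ → ∀ {n} → Graph n → Set
IsMinimalInM x y {n} G = InM x y G × (∀ m (H : Graph m) → InM x y H → n ≤ m)

-- Let G be minimal in M(x,y), with χ = c, ω = w and n vertices, so n + 2w + x < 3c.
-- G is not complete (else n = w = c), so some vertex u lies outside a maximum clique K.
-- Then χ(G − u) = c − 1: otherwise G − u, which still has clique number w, would be a
-- smaller member of M. Deleting an independent set I ∋ u therefore leaves a graph with
-- χ = c − 1 and ω ≥ w − 1, which is again in M as soon as n − |I| + 2w + x + 3 < 3c.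
-- With |I| = 3 this rules out α ≥ 3; then colour classes of G − u have at most two
-- vertices, giving n − 1 ≤ 2(c − 1). Finally u has a non-neighbour v (else K + u is a
-- larger clique); deleting {u, v} is impossible, so 3c ≤ n + 2w + x + 1, and combining
-- with n + 1 ≤ 2c gives 4(c − w) − 2x − 1 ≤ n.
module Submission where

open import Defs hiding (sym)
open import Data.Bool as Bool using (true; false)
open import Data.Bool.Properties using (not-¬; ¬-not)
open import Data.Empty using (⊥; ⊥-elim)
open import Data.Fin as Fin using (Fin; zero; suc; punchIn; punchOut)
import Data.Fin.Properties as Finₚ
open import Data.Fin.Permutation.Components using (transpose; transpose-inverse)
open import Data.Integer as ℤ using (ℤ; +_; -[1+_]; +≤+; +<+)
import Data.Integer.Properties as ℤₚ
open import Data.Integer.Tactic.RingSolver as ℤ-Solver using ()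
open import Data.Nat as ℕ using (ℕ; zero; suc; _+_; _*_; _≤_; _<_; z≤n; s≤s)
open import Data.Nat.Induction using (<-rec)
import Data.Nat.Properties as ℕₚ
open import Data.Nat.Tactic.RingSolver as ℕ-Solver using ()
open import Data.Product using (Σ; ∃; _×_; _,_; proj₁; proj₂)
open import Data.Sum using (_⊎_; inj₁; inj₂)
open import Effect.Monad using (RawMonad)
open import Function using (_∘_; id)
open import Function.Definitions using (Injective)
open import Level using (0ℓ)
open import Relation.Binary.Definitions using (tri<; tri≈; tri>)
open import Relation.Binary.PropositionalEquality
open import Relation.Nullary using (¬_; yes; no)
open import Relation.Nullary.Decidable using (¬¬-excluded-middle; decidable-stable; _×-dec_; ¬?)
open import Relation.Nullary.Negation using (¬¬-Monad; ¬¬-map)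
open import Relation.Unary using (Decidable)

open RawMonad (¬¬-Monad {0ℓ}) using (_>>=_; return)

-- Least and greatest witnesses of undecidable predicates (such as colourability) exist
-- only under double negation; that suffices, since everything concluded from them is decidable.
Least : (ℕ → Set) → Set
Least P = ∃ λ k → P k × (∀ j → P j → k ≤ j)

Greatest : (ℕ → Set) → Set
Greatest P = ∃ λ k → P k × (∀ j → P j → j ≤ k)

¬¬-least : ∀ {P : ℕ → Set} k → P k → ¬ ¬ Least P
¬¬-least {P} = <-rec (λ k → P k → ¬ ¬ Least P) step
  where
  step : ∀ k → (∀ {j} → j < k → P j → ¬ ¬ Least P) → P k → ¬ ¬ Least P
  step k below pk = ¬¬-excluded-middle {A = ∃ λ j → j < k × P j} >>= λ where
    (yes (j , j<k , pj)) → below j<k pj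
    (no none) → return (k , pk , λ j pj → ℕₚ.≮⇒≥ λ j<k → none (j , j<k , pj))

¬¬-greatest : ∀ {P : ℕ → Set} {k} b → P k → (∀ j → P j → j ≤ b) → ¬ ¬ Greatest P
¬¬-greatest {k = k} zero pk bounded = return (k , pk , λ j pj → ℕₚ.≤-trans (bounded j pj) z≤n)
¬¬-greatest {P} (suc b) pk bounded = ¬¬-excluded-middle {A = P (suc b)} >>= λ where
  (yes pb) → return (suc b , pb , bounded)
  (no ¬pb) → ¬¬-greatest b pk λ j pj →
    ℕₚ.≤-pred (ℕₚ.≤∧≢⇒< (bounded j pj) λ where refl → ¬pb pj)

adjacent⇒distinct : ∀ {n} (G : Graph n) {u v} → adj G u v ≡ true → u ≢ v
adjacent⇒distinct G {u} uv refl = not-¬ uv (irrefl G u)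

induced : ∀ {m n} → Graph n → (Fin m → Fin n) → Graph m
induced G e = record
  { adj = λ i j → adj G (e i) (e j)
  ; sym = λ i j → Graph.sym G (e i) (e j)
  ; irrefl = irrefl G ∘ e
  }

colouring-restrict : ∀ {m n k} (G : Graph n) (e : Fin m → Fin n) → Colouring G k → Colouring (induced G e) k
colouring-restrict G e (col , proper) = col ∘ e , λ u v → proper (e u) (e v)

clique-lift : ∀ {m n j} (G : Graph n) {e : Fin m → Fin n} → Injective _≡_ _≡_ e →
              Clique (induced G e) j → Clique G j
clique-lift G {e} e-inj (K , K-inj , K-adj) = e ∘ K , K-inj ∘ e-inj , K-adj

independent-lift : ∀ {m n j} (G : Graph n) {e : Fin m → Fin n} → Injective _≡_ _≡_ e →
                   Independent (induced G e) j → Independent G j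
independent-lift G {e} e-inj (I , I-inj , I-adj) = e ∘ I , I-inj ∘ e-inj , I-adj

Image : ∀ {s n} → (Fin s → Fin n) → Fin n → Set
Image f v = ∃ λ i → f i ≡ v

image? : ∀ {s n} (f : Fin s → Fin n) → Decidable (Image f)
image? f v = Finₚ.any? λ i → f i Fin.≟ v

module _ {n} (G : Graph n) where

  sameColour⇒nonadjacent : ∀ {k u v} ((col , _) : Colouring G k) → col u ≡ col v → adj G u v ≡ false
  sameColour⇒nonadjacent {u = u} {v} (col , proper) same = ¬-not λ uv → proper u v uv same

  clique-reindex : ∀ {a b} {g : Fin a → Fin b} → Injective _≡_ _≡_ g → Clique G b → Clique G a
  clique-reindex {g = g} g-inj (K , K-inj , K-adj) =
    K ∘ g , g-inj ∘ K-inj , λ i j i≢j → K-adj _ _ (i≢j ∘ g-inj)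

  independent-reindex : ∀ {a b} {g : Fin a → Fin b} → Injective _≡_ _≡_ g → Independent G b → Independent G a
  independent-reindex {g = g} g-inj (I , I-inj , I-adj) =
    I ∘ g , g-inj ∘ I-inj , λ i j i≢j → I-adj _ _ (i≢j ∘ g-inj)

  independent-shrink : ∀ {a b} → a ≤ b → Independent G b → Independent G a
  independent-shrink a≤b = independent-reindex (Finₚ.inject≤-injective a≤b a≤b _ _)

  independent-reorder : ∀ {s} ((I , _) : Independent G (suc s)) (r : Fin (suc s)) →
                        Σ (Independent G (suc s)) λ (J , _) → J zero ≡ I r
  independent-reorder I r = independent-reindex swap-injective I , refl
    where
    swap-injective : Injective _≡_ _≡_ (transpose zero r)
    swap-injective {i} {j} eq = begin
      i                                       ≡⟨ transpose-inverse r zero ⟨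
      transpose r zero (transpose zero r i)   ≡⟨ cong (transpose r zero) eq ⟩
      transpose r zero (transpose zero r j)   ≡⟨ transpose-inverse r zero ⟩
      j                                       ∎
      where open ≡-Reasoning

  independent-outside-clique : ∀ {s w} ((I , _) : Independent G (suc (suc s))) ((K , _) : Clique G w) →
                               ∃ λ r → ¬ Image K (I r)
  independent-outside-clique (I , I-inj , I-adj) (K , K-inj , K-adj) with image? K (I zero) | image? K (I (suc zero))
  ... | no I₀∉K | _ = zero , I₀∉K
  ... | yes _ | no I₁∉K = suc zero , I₁∉K
  ... | yes (p , Kp≡I₀) | yes (q , Kq≡I₁) = ⊥-elim (not-¬ adjacent nonadjacent)
    where
    adjacent : adj G (K p) (K q) ≡ true
    adjacent = K-adj p q λ where refl → Finₚ.0≢1+n (I-inj (trans (sym Kp≡I₀) Kq≡I₁))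
    nonadjacent : adj G (K p) (K q) ≡ false
    nonadjacent rewrite Kp≡I₀ | Kq≡I₁ = I-adj zero (suc zero) λ ()

  pair : ∀ {u v} → u ≢ v → adj G u v ≡ false → Independent G 2
  pair {u} {v} u≢v uv = I , I-inj , I-adj
    where
    I : Fin 2 → Fin n
    I zero = u
    I (suc zero) = v
    I-inj : Injective _≡_ _≡_ I
    I-inj {zero} {zero} _ = refl
    I-inj {zero} {suc zero} = ⊥-elim ∘ u≢v
    I-inj {suc zero} {zero} = ⊥-elim ∘ u≢v ∘ sym
    I-inj {suc zero} {suc zero} _ = refl
    I-adj : ∀ i j → i ≢ j → adj G (I i) (I j) ≡ false
    I-adj zero zero 0≢0 = ⊥-elim (0≢0 refl)
    I-adj zero (suc zero) _ = uv
    I-adj (suc zero) zero _ = trans (Graph.sym G v u) uv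
    I-adj (suc zero) (suc zero) 1≢1 = ⊥-elim (1≢1 refl)

  clique-extend : ∀ {w u} ((K , _) : Clique G w) → ¬ Image K u → (∀ i → adj G u (K i) ≡ true) →
                  Clique G (suc w)
  clique-extend {u = u} (K , K-inj , K-adj) u∉K uK = K′ , K′-inj , K′-adj
    where
    K′ : Fin (suc _) → Fin n
    K′ zero = u
    K′ (suc i) = K i
    K′-inj : Injective _≡_ _≡_ K′
    K′-inj {zero} {zero} _ = refl
    K′-inj {zero} {suc j} eq = ⊥-elim (u∉K (j , sym eq))
    K′-inj {suc i} {zero} eq = ⊥-elim (u∉K (i , eq))
    K′-inj {suc i} {suc j} eq = cong suc (K-inj eq)
    K′-adj : ∀ i j → i ≢ j → adj G (K′ i) (K′ j) ≡ true
    K′-adj zero zero 0≢0 = ⊥-elim (0≢0 refl)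
    K′-adj zero (suc j) _ = uK j
    K′-adj (suc i) zero _ = trans (Graph.sym G (K i) u) (uK i)
    K′-adj (suc i) (suc j) i≢j = K-adj i j (i≢j ∘ cong suc)

  -- Each colour class has at most two vertices; a vertex is labelled by its colour
  -- and by whether an earlier vertex has the same colour.
  order≤2*colours : ∀ {k} → ¬ Independent G 3 → Colouring G k → n ≤ k * 2
  order≤2*colours {k} no3 (col , proper) = Finₚ.injective⇒≤ label-injective
    where
    HasEarlierTwin : Fin n → Set
    HasEarlierTwin v = ∃ λ u → u Fin.< v × col u ≡ col v
    earlierTwin? : Decidable HasEarlierTwin
    earlierTwin? v = Finₚ.any? λ u → (u Finₚ.<? v) ×-dec (col u Finₚ.≟ col v)
    rank : Fin n → Fin 2
    rank v with earlierTwin? v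
    ... | yes _ = suc zero
    ... | no _ = zero
    label : Fin n → Fin (k * 2)
    label v = Fin.combine (col v) (rank v)
    triple : ∀ {u v v′} → u Fin.< v → v Fin.< v′ → col u ≡ col v → col v ≡ col v′ → Independent G 3
    triple {u} {v} {v′} u<v v<v′ same same′ =
      I , I-inj , λ i j _ → sameColour⇒nonadjacent (col , proper) (same-I i j)
      where
      u<v′ = Finₚ.<-trans u<v v<v′
      I : Fin 3 → Fin n
      I zero = u
      I (suc zero) = v
      I (suc (suc zero)) = v′
      same-I : ∀ i j → col (I i) ≡ col (I j)
      same-I i j = trans (toColour i) (sym (toColour j))
        where
        toColour : ∀ i → col (I i) ≡ col v
        toColour zero = same
        toColour (suc zero) = refl
        toColour (suc (suc zero)) = sym same′
      I-inj : Injective _≡_ _≡_ I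
      I-inj {zero} {zero} _ = refl
      I-inj {zero} {suc zero} = ⊥-elim ∘ Finₚ.<⇒≢ u<v
      I-inj {zero} {suc (suc zero)} = ⊥-elim ∘ Finₚ.<⇒≢ u<v′
      I-inj {suc zero} {zero} = ⊥-elim ∘ Finₚ.<⇒≢ u<v ∘ sym
      I-inj {suc zero} {suc zero} _ = refl
      I-inj {suc zero} {suc (suc zero)} = ⊥-elim ∘ Finₚ.<⇒≢ v<v′
      I-inj {suc (suc zero)} {zero} = ⊥-elim ∘ Finₚ.<⇒≢ u<v′ ∘ sym
      I-inj {suc (suc zero)} {suc zero} = ⊥-elim ∘ Finₚ.<⇒≢ v<v′ ∘ sym
      I-inj {suc (suc zero)} {suc (suc zero)} _ = refl
    ordered-twins : ∀ {v v′} → v Fin.< v′ → col v ≡ col v′ → rank v ≢ rank v′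
    ordered-twins {v} {v′} v<v′ same with earlierTwin? v | earlierTwin? v′
    ... | yes (u , u<v , same₀) | _ = λ _ → no3 (triple u<v v<v′ same₀ same)
    ... | no _ | yes _ = Finₚ.0≢1+n
    ... | no _ | no none = λ _ → none (v , v<v′ , same)
    label-injective : Injective _≡_ _≡_ label
    label-injective {v} {v′} eq
      with Finₚ.combine-injective (col v) (rank v) (col v′) (rank v′) eq | Finₚ.<-cmp v v′
    ... | same , ranks | tri< v<v′ _ _ = ⊥-elim (ordered-twins v<v′ same ranks)
    ... | _ | tri≈ _ v≡v′ _ = v≡v′
    ... | same , ranks | tri> _ _ v′<v = ⊥-elim (ordered-twins v′<v (sym same) (sym ranks))

  singleton : Fin n → Independent G 1
  singleton u = (λ _ → u) , (λ { {zero} {zero} _ → refl }) , λ { zero zero 0≢0 → ⊥-elim (0≢0 refl) }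

  chromaticNumber-unique : ∀ {c c′} → IsChromaticNumber G c → IsChromaticNumber G c′ → c ≡ c′
  chromaticNumber-unique (col , least) (col′ , least′) = ℕₚ.≤-antisym (least _ col′) (least′ _ col)

  cliqueNumber-unique : ∀ {w w′} → IsCliqueNumber G w → IsCliqueNumber G w′ → w ≡ w′
  cliqueNumber-unique (K , greatest) (K′ , greatest′) = ℕₚ.≤-antisym (greatest′ _ K) (greatest _ K′)

  chromaticNumber≤order : ∀ {c} → IsChromaticNumber G c → c ≤ n
  chromaticNumber≤order (_ , least) = least n (id , λ u v uv → adjacent⇒distinct G uv)

  covering-clique⇒order≤ : ∀ {w} ((K , _) : Clique G w) → (∀ v → Image K v) → n ≤ w
  covering-clique⇒order≤ (K , _) covering = Finₚ.injective⇒≤ {f = proj₁ ∘ covering} λ {u} {v} eq →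
    trans (sym (proj₂ (covering u))) (trans (cong K eq) (proj₂ (covering v)))

  ¬¬-chromaticNumber : ∀ {k} → Colouring G k → ¬ ¬ ∃ (IsChromaticNumber G)
  ¬¬-chromaticNumber = ¬¬-least _

  ¬¬-cliqueNumber : ¬ ¬ ∃ (IsCliqueNumber G)
  ¬¬-cliqueNumber = ¬¬-greatest n emptyClique λ _ (K , K-inj , _) → Finₚ.injective⇒≤ K-inj
    where
    emptyClique : Clique G 0
    emptyClique = (λ ()) , (λ {i} → ⊥-elim (Finₚ.¬Fin0 i)) , λ ()

-- Vertex deletion

record Deletion {n} (D : Fin n → Set) : Set where
  field
    size : ℕ
    embed : Fin size → Fin n
    embed-injective : Injective _≡_ _≡_ embed
    covers : ∀ v → Image embed v ⊎ D v
open Deletion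

_∖_ : ∀ {n} {D : Fin n → Set} (G : Graph n) (δ : Deletion D) → Graph (size δ)
G ∖ δ = induced G (embed δ)

IndependentOn : ∀ {n} → Graph n → (Fin n → Set) → Set
IndependentOn G D = ∀ u v → D u → D v → adj G u v ≡ false

module _ {n} {D : Fin n → Set} (G : Graph n) (δ : Deletion D) where

  colouring-extend : IndependentOn G D → ∀ {k} → Colouring (G ∖ δ) k → Colouring G (suc k)
  colouring-extend D-ind {k} (col , proper) = col′ ∘ covers δ , proper′
    where
    col′ : ∀ {v} → Image (embed δ) v ⊎ D v → Fin (suc k)
    col′ (inj₁ (i , _)) = Fin.inject₁ (col i)
    col′ (inj₂ _) = Fin.fromℕ k
    proper′ : ∀ u v → adj G u v ≡ true → col′ (covers δ u) ≢ col′ (covers δ v)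
    proper′ u v uv with covers δ u | covers δ v
    ... | inj₁ (i , refl) | inj₁ (j , refl) = proper i j uv ∘ Finₚ.inject₁-injective
    ... | inj₁ (i , refl) | inj₂ _ = Finₚ.fromℕ≢inject₁ ∘ sym
    ... | inj₂ _ | inj₁ (j , refl) = Finₚ.fromℕ≢inject₁
    ... | inj₂ Du | inj₂ Dv = λ _ → not-¬ uv (D-ind u v Du Dv)

  clique-avoiding : ∀ {w} ((K , K-inj , K-adj) : Clique G w) → (∀ i → ¬ D (K i)) → Clique (G ∖ δ) w
  clique-avoiding (K , K-inj , K-adj) K∉D = K′ , K′-inj , K′-adj
    where
    preimage : ∀ i → Image (embed δ) (K i)
    preimage i with covers δ (K i)
    ... | inj₁ p = p
    ... | inj₂ d = ⊥-elim (K∉D i d)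
    K′ = proj₁ ∘ preimage
    K′-inj : Injective _≡_ _≡_ K′
    K′-inj {i} {j} eq =
      K-inj (trans (sym (proj₂ (preimage i))) (trans (cong (embed δ) eq) (proj₂ (preimage j))))
    K′-adj : ∀ i j → i ≢ j → adj G (embed δ (K′ i)) (embed δ (K′ j)) ≡ true
    K′-adj i j i≢j rewrite proj₂ (preimage i) | proj₂ (preimage j) = K-adj i j i≢j

  -- a clique meets an independent set at most once
  clique-shrink : IndependentOn G D → Decidable D → ∀ {w} → Clique G (suc w) → Clique (G ∖ δ) w
  clique-shrink D-ind D? (K , K-inj , K-adj) with Finₚ.any? (D? ∘ K)
  ... | no K∉D = clique-avoiding (clique-reindex G Finₚ.suc-injective (K , K-inj , K-adj))
                   λ i d → K∉D (suc i , d)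
  ... | yes (i₀ , Di₀) = clique-avoiding (clique-reindex G (Finₚ.punchIn-injective i₀ _ _) (K , K-inj , K-adj))
                           λ i d → not-¬ (K-adj i₀ (punchIn i₀ i) (Finₚ.punchInᵢ≢i i₀ i ∘ sym)) (D-ind _ _ Di₀ d)

punchOutTail : ∀ {s n} (f : Fin (suc s) → Fin (suc n)) → Injective _≡_ _≡_ f → Fin s → Fin n
punchOutTail f f-inj i = punchOut {i = f zero} {j = f (suc i)} (Finₚ.0≢1+n ∘ f-inj)

punchOutTail-injective : ∀ {s n} (f : Fin (suc s) → Fin (suc n)) (f-inj : Injective _≡_ _≡_ f) →
                         Injective _≡_ _≡_ (punchOutTail f f-inj)
punchOutTail-injective f f-inj {i} {j} = Finₚ.suc-injective ∘ f-inj ∘ Finₚ.punchOut-injective {i = f zero} _ _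

deleteImage : ∀ {s n} (f : Fin s → Fin n) → Injective _≡_ _≡_ f → Deletion (Image f)
deleteImage {zero} f _ = record { size = _ ; embed = id ; embed-injective = id ; covers = λ v → inj₁ (v , refl) }
deleteImage {suc s} {zero} f _ with () ← f zero
deleteImage {suc s} {suc n} f f-inj = record
  { size = size δ
  ; embed = punchIn u ∘ embed δ
  ; embed-injective = embed-injective δ ∘ Finₚ.punchIn-injective u _ _
  ; covers = covers′
  }
  where
  u = f zero
  δ = deleteImage (punchOutTail f f-inj) (punchOutTail-injective f f-inj)
  covers′ : ∀ v → Image (punchIn u ∘ embed δ) v ⊎ Image f v
  covers′ v with u Fin.≟ v
  ... | yes u≡v = inj₂ (zero , u≡v)
  ... | no u≢v with covers δ (punchOut u≢v)
  ...   | inj₁ (i , eq) = inj₁ (i , trans (cong (punchIn u) eq) (Finₚ.punchIn-punchOut u≢v))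
  ...   | inj₂ (i , eq) = inj₂ (suc i , (begin
          f (suc i)                                  ≡⟨ Finₚ.punchIn-punchOut _ ⟨
          punchIn u (punchOutTail f f-inj i)         ≡⟨ cong (punchIn u) eq ⟩
          punchIn u (punchOut u≢v)                   ≡⟨ Finₚ.punchIn-punchOut u≢v ⟩
          v                                          ∎))
    where open ≡-Reasoning

size-deleteImage : ∀ {s n} (f : Fin s → Fin n) (f-inj : Injective _≡_ _≡_ f) →
                   size (deleteImage f f-inj) + s ≡ n
size-deleteImage {zero} f _ = ℕₚ.+-identityʳ _
size-deleteImage {suc s} {zero} f _ with () ← f zero
size-deleteImage {suc s} {suc n} f f-inj = trans (ℕₚ.+-suc _ s)
  (cong suc (size-deleteImage (punchOutTail f f-inj) (punchOutTail-injective f f-inj)))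

_−_ : ∀ {n s} (G : Graph n) (I : Independent G s) → Graph (size (deleteImage (proj₁ I) (proj₁ (proj₂ I))))
G − (I , I-inj , _) = G ∖ deleteImage I I-inj

module _ {n} (G : Graph n) where

  image-independentOn : ∀ {s} ((I , _) : Independent G s) → IndependentOn G (Image I)
  image-independentOn (I , _ , I-adj) _ _ (i , refl) (j , refl) with i Fin.≟ j
  ... | yes refl = irrefl G (I i)
  ... | no i≢j = I-adj i j i≢j

  clique-lift-minus : ∀ {s j} (I : Independent G s) → Clique (G − I) j → Clique G j
  clique-lift-minus (I , I-inj , _) = clique-lift G (embed-injective (deleteImage I I-inj))

  independent-lift-minus : ∀ {s j} (I : Independent G s) → Independent (G − I) j → Independent G j
  independent-lift-minus (I , I-inj , _) = independent-lift G (embed-injective (deleteImage I I-inj))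

  chromaticNumber-minus-lower : ∀ {c s k} → IsChromaticNumber G c → (I : Independent G s) →
                                Colouring (G − I) k → c ≤ suc k
  chromaticNumber-minus-lower (_ , least) I@(f , f-inj , _) col =
    least _ (colouring-extend G (deleteImage f f-inj) (image-independentOn I) col)

  cliqueNumber-minus : ∀ {w s w′} → IsCliqueNumber G w → (I : Independent G s) → IsCliqueNumber (G − I) w′ →
                       w′ ≤ w × w ≤ suc w′
  cliqueNumber-minus {zero} (_ , greatest) I (K′ , _) = greatest _ (clique-lift-minus I K′) , z≤n
  cliqueNumber-minus {suc w} (K , greatest) I@(f , f-inj , _) (K′ , greatest′) =
    greatest _ (clique-lift-minus I K′) ,
    s≤s (greatest′ _ (clique-shrink G (deleteImage f f-inj) (image-independentOn I) (image? f) K))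

  cliqueNumber-minus-avoiding : ∀ {w s} ((K , _) : IsCliqueNumber G w) (I : Independent G s) →
                                (∀ i → ¬ Image (proj₁ I) (proj₁ K i)) → IsCliqueNumber (G − I) w
  cliqueNumber-minus-avoiding (K , greatest) I@(f , f-inj , _) K∉I =
    clique-avoiding G (deleteImage f f-inj) K K∉I , λ j K′ → greatest j (clique-lift-minus I K′)

module _ {n} (G : Graph (suc n)) where

  -- deleteImage removes I zero first, so G − I is by definition an induced subgraph of G − I zero.
  chromaticNumber-minus : ∀ {k s} → IsChromaticNumber G (suc k) → (I : Independent G (suc s)) →
                          IsChromaticNumber (G − singleton G (proj₁ I zero)) k → IsChromaticNumber (G − I) k
  chromaticNumber-minus χ I@(f , f-inj , _) (col , _) =
    colouring-restrict (G − singleton G (f zero)) rest col ,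
    λ j colj → ℕₚ.≤-pred (chromaticNumber-minus-lower G χ I colj)
    where rest = embed (deleteImage (punchOutTail f f-inj) (punchOutTail-injective f f-inj))

i+k<j⇒i<j-k : ∀ {i j} k → i ℤ.+ k ℤ.< j → i ℤ.< j ℤ.- k
i+k<j⇒i<j-k {i} {j} k lt = subst (ℤ._< j ℤ.- k) (cancel i k) (ℤₚ.+-monoˡ-< (ℤ.- k) lt)
  where cancel : ∀ i k → i ℤ.+ k ℤ.- k ≡ i
        cancel = ℤ-Solver.solve-∀

i<j-k⇒i+k<j : ∀ {i j} k → i ℤ.< j ℤ.- k → i ℤ.+ k ℤ.< j
i<j-k⇒i+k<j {i} {j} k lt = subst (i ℤ.+ k ℤ.<_) (cancel j k) (ℤₚ.+-monoˡ-< k lt)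
  where cancel : ∀ j k → j ℤ.- k ℤ.+ k ≡ j
        cancel = ℤ-Solver.solve-∀

i+k≤j⇒i≤j-k : ∀ {i j} k → i ℤ.+ k ℤ.≤ j → i ℤ.≤ j ℤ.- k
i+k≤j⇒i≤j-k {i} {j} k le = subst (ℤ._≤ j ℤ.- k) (cancel i k) (ℤₚ.+-monoˡ-≤ (ℤ.- k) le)
  where cancel : ∀ i k → i ℤ.+ k ℤ.- k ≡ i
        cancel = ℤ-Solver.solve-∀

i≤j+k⇒i-k≤j : ∀ {i j} k → i ℤ.≤ j ℤ.+ k → i ℤ.- k ℤ.≤ j
i≤j+k⇒i-k≤j {i} {j} k le = subst (i ℤ.- k ℤ.≤_) (cancel j k) (ℤₚ.+-monoˡ-≤ (ℤ.- k) le)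
  where cancel : ∀ j k → j ℤ.+ k ℤ.- k ≡ j
        cancel = ℤ-Solver.solve-∀

inM-rhs : ∀ c w X → + c ℤ.+ + 2 ℤ.* (+ c ℤ.- + w) ℤ.- + X ≡ + (3 * c) ℤ.- + (2 * w + X)
inM-rhs c w X = begin
    + c ℤ.+ + 2 ℤ.* (+ c ℤ.- + w) ℤ.- + X   ≡⟨ rearrange (+ c) (+ w) (+ X) ⟩
    + 3 ℤ.* + c ℤ.- (+ 2 ℤ.* + w ℤ.+ + X)
      ≡⟨ cong₂ (λ a b → a ℤ.- (b ℤ.+ + X)) (ℤₚ.pos-* 3 c) (ℤₚ.pos-* 2 w) ⟨
    + (3 * c) ℤ.- + (2 * w + X)             ∎
  where
  open ≡-Reasoning
  rearrange : ∀ c w x → c ℤ.+ + 2 ℤ.* (c ℤ.- w) ℤ.- x ≡ + 3 ℤ.* c ℤ.- (+ 2 ℤ.* w ℤ.+ x)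
  rearrange = ℤ-Solver.solve-∀

inM-order⇒ : ∀ {n c w X} → + n ℤ.< + c ℤ.+ + 2 ℤ.* (+ c ℤ.- + w) ℤ.- + X → n + (2 * w + X) < 3 * c
inM-order⇒ {n} {c} {w} {X} = ℤₚ.drop‿+<+ ∘ i<j-k⇒i+k<j (+ (2 * w + X)) ∘ subst (+ n ℤ.<_) (inM-rhs c w X)

inM-order⇐ : ∀ {n c w X} → n + (2 * w + X) < 3 * c → + n ℤ.< + c ℤ.+ + 2 ℤ.* (+ c ℤ.- + w) ℤ.- + X
inM-order⇐ {n} {c} {w} {X} = subst (+ n ℤ.<_) (sym (inM-rhs c w X)) ∘ i+k<j⇒i<j-k (+ (2 * w + X)) ∘ +<+

gap-step : ∀ {y k w w′} → + suc k ℤ.- + w ℤ.≤ y → w ≤ suc w′ → + k ℤ.- + w′ ℤ.≤ y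
gap-step {y} {k} {w} {w′} gap w≤1+w′ = begin
    + k ℤ.- + w′              ≡⟨ shift (+ k) (+ w′) ⟩
    + suc k ℤ.- + suc w′      ≤⟨ ℤₚ.+-monoʳ-≤ (+ suc k) (ℤₚ.neg-mono-≤ (+≤+ w≤1+w′)) ⟩
    + suc k ℤ.- + w           ≤⟨ gap ⟩
    y                         ∎
  where
  open ℤₚ.≤-Reasoning
  shift : ∀ k w → k ℤ.- w ≡ (+ 1 ℤ.+ k) ℤ.- (+ 1 ℤ.+ w)
  shift = ℤ-Solver.solve-∀

order-target : ∀ {n c} → n + 1 ≤ 2 * c → + n ℤ.≤ + 2 ℤ.* + c ℤ.- + 1
order-target {n} {c} = subst (λ z → + n ℤ.≤ z ℤ.- + 1) (ℤₚ.pos-* 2 c) ∘ i+k≤j⇒i≤j-k (+ 1) ∘ +≤+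

deficiency-target : ∀ {n c w X} → 4 * c ≤ n + (4 * w + 2 * X + 1) →
                    + 4 ℤ.* (+ c ℤ.- + w) ℤ.- + 2 ℤ.* + X ℤ.- + 1 ℤ.≤ + n
deficiency-target {n} {c} {w} {X} = subst (ℤ._≤ + n) lhs ∘ i≤j+k⇒i-k≤j (+ (4 * w + 2 * X + 1)) ∘ +≤+
  where
  open ≡-Reasoning
  rearrange : ∀ c w x →
              + 4 ℤ.* c ℤ.- (+ 4 ℤ.* w ℤ.+ + 2 ℤ.* x ℤ.+ + 1) ≡ + 4 ℤ.* (c ℤ.- w) ℤ.- + 2 ℤ.* x ℤ.- + 1
  rearrange = ℤ-Solver.solve-∀
  lhs : + (4 * c) ℤ.- + (4 * w + 2 * X + 1) ≡ + 4 ℤ.* (+ c ℤ.- + w) ℤ.- + 2 ℤ.* + X ℤ.- + 1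
  lhs = begin
    + (4 * c) ℤ.- (+ (4 * w) ℤ.+ + (2 * X) ℤ.+ + 1)
      ≡⟨ cong₂ ℤ._-_ (ℤₚ.pos-* 4 c)
                     (cong₂ (λ a b → a ℤ.+ b ℤ.+ + 1) (ℤₚ.pos-* 4 w) (ℤₚ.pos-* 2 X)) ⟩
    + 4 ℤ.* + c ℤ.- (+ 4 ℤ.* + w ℤ.+ + 2 ℤ.* + X ℤ.+ + 1)
      ≡⟨ rearrange (+ c) (+ w) (+ X) ⟩
    + 4 ℤ.* (+ c ℤ.- + w) ℤ.- + 2 ℤ.* + X ℤ.- + 1
      ∎

removal-bound : ∀ {p s n r r′ k} → p + suc s ≡ n → r′ ≤ r → n + r + 3 < 3 * suc k + suc s →
                p + r′ < 3 * k
removal-bound {p} {s} {n} {r} {r′} {k} sizes r′≤r lt =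
  ℕₚ.+-cancelʳ-< 3 _ _ (ℕₚ.+-cancelʳ-< (suc s) _ _ (begin-strict
    p + r′ + 3 + suc s          ≤⟨ ℕₚ.+-monoˡ-≤ (suc s) (ℕₚ.+-monoˡ-≤ 3 (ℕₚ.+-monoʳ-≤ p r′≤r)) ⟩
    p + r + 3 + suc s           ≡⟨ regroup p r (suc s) ⟩
    p + suc s + r + 3           ≡⟨ cong (λ z → z + r + 3) sizes ⟩
    n + r + 3                   <⟨ lt ⟩
    3 * suc k + suc s           ≡⟨ cong (_+ suc s) (ℕₚ.*-suc 3 k) ⟩
    3 + 3 * k + suc s           ≡⟨ cong (_+ suc s) (ℕₚ.+-comm 3 (3 * k)) ⟩
    3 * k + 3 + suc s           ∎))
  where
  open ℕₚ.≤-Reasoning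
  regroup : ∀ p r t → p + r + 3 + t ≡ p + t + r + 3
  regroup = ℕ-Solver.solve-∀

twoColourClasses-bound : ∀ {m k} → m ≤ k * 2 → suc m + 1 ≤ 2 * suc k
twoColourClasses-bound {m} {k} m≤2k = subst₂ _≤_ (lhs m) (rhs k) (ℕₚ.+-monoʳ-≤ 2 m≤2k)
  where
  lhs : ∀ m → 2 + m ≡ suc m + 1
  lhs = ℕ-Solver.solve-∀
  rhs : ∀ k → 2 + k * 2 ≡ 2 * suc k
  rhs = ℕ-Solver.solve-∀

deficiency-bound : ∀ {n c w X} → 3 * c ≤ n + (2 * w + X) + 1 → n + 1 ≤ 2 * c →
                   4 * c ≤ n + (4 * w + 2 * X + 1)
deficiency-bound {n} {c} {w} {X} upper lower = ℕₚ.+-cancelʳ-≤ (n + 1) _ _ (begin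
  4 * c + (n + 1)                          ≤⟨ ℕₚ.+-monoʳ-≤ (4 * c) lower ⟩
  4 * c + 2 * c                            ≡⟨ six c ⟩
  2 * (3 * c)                              ≤⟨ ℕₚ.*-monoʳ-≤ 2 upper ⟩
  2 * (n + (2 * w + X) + 1)                ≡⟨ expand n w X ⟩
  n + (4 * w + 2 * X + 1) + (n + 1)        ∎)
  where
  open ℕₚ.≤-Reasoning
  six : ∀ c → 4 * c + 2 * c ≡ 2 * (3 * c)
  six = ℕ-Solver.solve-∀
  expand : ∀ n w x → 2 * (n + (2 * w + x) + 1) ≡ n + (4 * w + 2 * x + 1) + (n + 1)
  expand = ℕ-Solver.solve-∀

-- Minimal graphs of M(x, y)

outsideVertex : ∀ {n X c w} {G : Graph n} → IsChromaticNumber G c → (ω : IsCliqueNumber G w) →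
                n + (2 * w + X) < 3 * c → ∃ λ u → ¬ Image (proj₁ (proj₁ ω)) u
outsideVertex {n} {X} {c} {w} {G} χ ((K , K-clique) , _) small =
  Finₚ.¬∀⟶∃¬ n _ (image? K) (ℕₚ.<⇒≱ small ∘ order+2ω≥3χ)
  where
  order+2ω≥3χ : (∀ v → Image K v) → 3 * c ≤ n + (2 * w + X)
  order+2ω≥3χ covering = ℕₚ.+-mono-≤ c≤n (ℕₚ.≤-trans (ℕₚ.*-monoʳ-≤ 2 c≤w) (ℕₚ.m≤m+n _ X))
    where
    c≤n = chromaticNumber≤order G χ
    c≤w = ℕₚ.≤-trans c≤n (covering-clique⇒order≤ G (K , K-clique) covering)

-- small is the membership condition |V| < χ + 2f − x, rewritten as |V| + 2ω + x < 3χ.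
module MinimalGraph
  {X : ℕ} {y : ℤ} {m : ℕ} {G : Graph (suc m)}
  (minimal : ∀ n (H : Graph n) → InM (+ X) y H → suc m ≤ n)
  {c w : ℕ} (χ : IsChromaticNumber G c) (ω : IsCliqueNumber G w)
  (small : suc m + (2 * w + X) < 3 * c)
  (gap : + c ℤ.- + w ℤ.≤ y)
  where

  K : Fin w → Fin (suc m)
  K = proj₁ (proj₁ ω)

  minimal-order≤ : ∀ {n k w′} (H : Graph n) → IsChromaticNumber H k → IsCliqueNumber H w′ →
                   n + (2 * w′ + X) < 3 * k → + k ℤ.- + w′ ℤ.≤ y → suc m ≤ n
  minimal-order≤ {n} {k} {w′} H χH ωH smallH gapH =
    minimal n H (k , w′ , χH , ωH , inM-order⇐ {n} {k} {w′} {X} smallH , gapH)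

  cliqueNumber-minus-outside : ∀ {u} → ¬ Image K u → IsCliqueNumber (G − singleton G u) w
  cliqueNumber-minus-outside u∉K =
    cliqueNumber-minus-avoiding G ω (singleton G _) λ i (_ , u≡Ki) → u∉K (i , sym u≡Ki)

  chromaticNumber-minus-outside : ∀ {u} → ¬ Image K u →
                                  ¬ ¬ ∃ λ k → c ≡ suc k × IsChromaticNumber (G − singleton G u) k
  chromaticNumber-minus-outside {u} u∉K = ¬¬-map drops (¬¬-chromaticNumber (G − singleton G u) restricted)
    where
    restricted : Colouring (G − singleton G u) c
    restricted = colouring-restrict G _ (proj₁ χ)
    drops : ∃ (IsChromaticNumber (G − singleton G u)) →
            ∃ λ k → c ≡ suc k × IsChromaticNumber (G − singleton G u) k
    drops (k , χ-u) = k , ℕₚ.≤-antisym (chromaticNumber-minus-lower G χ (singleton G u) (proj₁ χ-u))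
                                      (ℕₚ.≤∧≢⇒< (proj₂ χ-u c restricted) k≢c) , χ-u
      where
      k≢c : k ≢ c
      k≢c refl = ℕₚ.1+n≰n (minimal-order≤ (G − singleton G u) χ-u (cliqueNumber-minus-outside u∉K)
                                          (ℕₚ.<-trans (ℕₚ.n<1+n _) small) gap)

  independent-outside-irremovable : ∀ {s} (I : Independent G (suc s)) → ¬ Image K (proj₁ I zero) →
                                    ¬ (suc m + (2 * w + X) + 3 < 3 * c + suc s)
  independent-outside-irremovable {s} I I₀∉K bound =
    chromaticNumber-minus-outside I₀∉K λ (k , c≡1+k , χ-u) →
    ¬¬-cliqueNumber (G − I) λ (w′ , ω′) →
    let w′≤w , w≤1+w′ = cliqueNumber-minus G ω I ω′
        χ′ = chromaticNumber-minus G (subst (IsChromaticNumber G) c≡1+k χ) I χ-u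
        small′ = removal-bound {r = 2 * w + X} {2 * w′ + X} sizes
                   (ℕₚ.+-monoˡ-≤ X (ℕₚ.*-monoʳ-≤ 2 w′≤w))
                   (subst (λ z → suc m + (2 * w + X) + 3 < 3 * z + suc s) c≡1+k bound)
        gap′ = gap-step (subst (λ z → + z ℤ.- + w ℤ.≤ y) c≡1+k gap) w≤1+w′
    in ℕₚ.<⇒≱ smaller (minimal-order≤ (G − I) χ′ ω′ small′ gap′)
    where
    δ = deleteImage (proj₁ I) (proj₁ (proj₂ I))
    sizes : size δ + suc s ≡ suc m
    sizes = size-deleteImage (proj₁ I) (proj₁ (proj₂ I))
    smaller : size δ < suc m
    smaller = subst (size δ <_) sizes (ℕₚ.m<m+n (size δ) (s≤s z≤n))

  ¬independent3 : ¬ Independent G 3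
  ¬independent3 I with independent-outside-clique G I (proj₁ ω)
  ... | r , Ir∉K with independent-reorder G I r
  ...   | J , J₀≡Ir =
    independent-outside-irremovable J (subst (¬_ ∘ Image K) (sym J₀≡Ir) Ir∉K) (ℕₚ.+-monoˡ-< 3 small)

  independence<3 : ∀ {a} → Independent G a → a < 3
  independence<3 I = ℕₚ.≰⇒> λ 3≤a → ¬independent3 (independent-shrink G 3≤a I)

  order<2χ : ∀ {u} → ¬ Image K u → suc m + 1 ≤ 2 * c
  order<2χ {u} u∉K = decidable-stable (_ ℕ.≤? _) (¬¬-map bound (chromaticNumber-minus-outside u∉K))
    where
    bound : ∃ (λ k → c ≡ suc k × IsChromaticNumber (G − singleton G u) k) → suc m + 1 ≤ 2 * c
    bound (k , c≡1+k , (col , _)) = subst (λ z → suc m + 1 ≤ 2 * z) (sym c≡1+k) (twoColourClasses-bound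
      (order≤2*colours (G − singleton G u) (¬independent3 ∘ independent-lift-minus G (singleton G u)) col))

  nonNeighbour : ∀ {u} → ¬ Image K u → ∃ λ v → u ≢ v × adj G u v ≡ false
  nonNeighbour {u} u∉K with Finₚ.any? (λ v → ¬? (u Fin.≟ v) ×-dec (adj G u v Bool.≟ false))
  ... | yes found = found
  ... | no none = ⊥-elim (ℕₚ.1+n≰n (proj₂ ω _ (clique-extend G (proj₁ ω) u∉K adjacent)))
    where
    adjacent : ∀ i → adj G u (K i) ≡ true
    adjacent i = ¬-not λ uKi≡false → none (K i , (λ u≡Ki → u∉K (i , sym u≡Ki)) , uKi≡false)

  deficiency-bounded : ∀ {u} → ¬ Image K u → 4 * c ≤ suc m + (4 * w + 2 * X + 1)
  deficiency-bounded u∉K with nonNeighbour u∉K | suc m + (2 * w + X) + 1 ℕ.<? 3 * c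
  ... | v , u≢v , uv | yes removable =
    ⊥-elim (independent-outside-irremovable (pair G u≢v uv) u∉K
      (subst (_< 3 * c + 2) (ℕₚ.+-assoc (suc m + (2 * w + X)) 1 2) (ℕₚ.+-monoˡ-< 2 removable)))
  ... | _ | no irremovable = deficiency-bound {suc m} {c} {w} {X} (ℕₚ.≮⇒≥ irremovable) (order<2χ u∉K)

minimalGraph-properties : ∀ {X y n} {G : Graph n} → (∀ m (H : Graph m) → InM (+ X) y H → n ≤ m) →
  ∀ {c w} → IsChromaticNumber G c → IsCliqueNumber G w → n + (2 * w + X) < 3 * c → + c ℤ.- + w ℤ.≤ y →
  (∀ {a} → Independent G a → a < 3) × n + 1 ≤ 2 * c × 4 * c ≤ n + (4 * w + 2 * X + 1)
minimalGraph-properties {X} {n = zero} {G} _ χ ω small _ =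
  ⊥-elim (Finₚ.¬Fin0 (proj₁ (outsideVertex {X = X} {G = G} χ ω small)))
minimalGraph-properties {X} {n = suc m} {G} minimal χ ω small gap =
  independence<3 , order<2χ u∉K , deficiency-bounded u∉K
  where
  open MinimalGraph {G = G} minimal χ ω small gap
  u∉K = proj₂ (outsideVertex {X = X} {G = G} χ ω small)

lemma3p2 : (x y : ℤ) → (+ 0) ℤ.≤ x →
    ∀ n (G₀ : Graph n) → IsMinimalInM x y G₀ →
    ∀ c w a → IsChromaticNumber G₀ c → IsCliqueNumber G₀ w → IsIndependenceNumber G₀ a →
    (a ℕ.< 3) ×
    ((+ n) ℤ.≤ (+ 2) ℤ.* (+ c) ℤ.- (+ 1)) ×
    ((+ 4) ℤ.* ((+ c) ℤ.- (+ w)) ℤ.- (+ 2) ℤ.* x ℤ.- (+ 1) ℤ.≤ (+ n))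
lemma3p2 (+ X) y _ n G₀ ((c′ , w′ , χ′ , ω′ , below , gap) , minimal) c w a χ ω α
  with refl ← chromaticNumber-unique G₀ χ′ χ | refl ← cliqueNumber-unique G₀ ω′ ω =
  let α<3 , order-upper , order-lower =
        minimalGraph-properties {X} {G = G₀} minimal χ ω (inM-order⇒ {n} {c} {w} {X} below) gap
  in α<3 (proj₁ α) , order-target {n} {c} order-upper , deficiency-target {n} {c} {w} {X} order-lower
lemma3p2 -[1+ _ ] _ () _ _ _ _ _ _ _ _ _
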